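{- Let $f$ be a binding function of a rooted tree $(T,r)$. Let $v_1,\dots,v_{\deg(r)}$ be the neighbours of $r$ in $T$. For $i\in\{1,\dots,\deg(r)\}$, let $T_i$ be the component subtree of $T-r$ that contains $v_i$, and let $c_i$ be the minimum cardinality of an outdegree-$f$ rooted covering of the rooted tree $(T_i,v_i)$, where $f$ is restricted to $V(T_i)$. Then the minimum cardinality of an outdegree-$f$ rooted covering of $(T,r)$ equals $$\max\left\{\max_{1\leq i\leq\deg(r)}c_i,\left\lceil\frac{1}{f(r)}\sum_{i=1}^{\deg(r)}c_i\right\rceil\right\}\enspace.$$
   Context: A rooted tree $(T,r)$ is obtained by orienting every edge of the tree $T$ away from the root $r$. A covering of a graph is a set of connected subgraphs such that every edge is in at least one subgraph. A rooted covering of a rooted tree is a covering by subtrees each containing the root. A binding function of a rooted tree $T$ is a function $f:V(T)\rightarrow\mathbb{Z}^+$. A rooted covering is outdegree-$f$ if $\mathrm{outdeg}_X(v)\leq f(v)$ for every vertex $v$ in every subtree $X$ of the covering. -}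

module Defs where

open import Data.Nat using (ℕ; zero; suc; _+_; _≤_; _⊔_; _/_)
open import Data.List using (List; []; _∷_; length; foldr)
open import Data.List.Relation.Unary.Any using (Any; here; there)
open import Data.List.Relation.Unary.All using (All)
open import Data.Unit using (⊤)
open import Data.Empty using (⊥)
open import Data.Product using (Σ; _×_)
open import Relation.Binary.PropositionalEquality using (_≡_)

-- Finite rooted trees (T,r) as rose trees, each vertex labelled with
-- the value f(v) of the binding function.  The root is the top node,
-- its children are its out-neighbours.  Restricting f to a component
-- subtree T_i of T - r is automatic: T_i is the i-th child with its
-- own labels.

data RTree : Set where
  node : (fv : ℕ) → (children : List RTree) → RTree

data Binding : RTree → Set where
  node : ∀ {k cs} → 1 ≤ k → All Binding cs → Binding (node k cs)

data Vertex : RTree → Set where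
  root  : ∀ {k cs} → Vertex (node k cs)
  below : ∀ {k cs} → Any Vertex cs → Vertex (node k cs)

data Edge : RTree → Set where
  rootEdge : ∀ {k cs} → Any (λ _ → ⊤) cs → Edge (node k cs)
  below    : ∀ {k cs} → Any Edge cs → Edge (node k cs)

-- Subtrees of (T,r) containing the root r: at each included vertex we
-- choose which children are included, and recursively a rooted subtree
-- of each included child.

mutual
  data Sub : RTree → Set where
    node : ∀ {k cs} → Subs cs → Sub (node k cs)

  data Subs : List RTree → Set where
    []   : Subs []
    skip : ∀ {c cs} → Subs cs → Subs (c ∷ cs)
    take : ∀ {c cs} → Sub c → Subs cs → Subs (c ∷ cs)

mutual
  _∋v_ : ∀ {t} → Sub t → Vertex t → Set
  node s ∋v root    = ⊤
  node s ∋v below a = s ∋vs a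

  _∋vs_ : ∀ {cs} → Subs cs → Any Vertex cs → Set
  skip s   ∋vs here v  = ⊥
  take x s ∋vs here v  = x ∋v v
  skip s   ∋vs there a = s ∋vs a
  take x s ∋vs there a = s ∋vs a

taken : ∀ {cs} → Subs cs → Any (λ _ → ⊤) cs → Set
taken (skip s)   (here _)  = ⊥
taken (take x s) (here _)  = ⊤
taken (skip s)   (there i) = taken s i
taken (take x s) (there i) = taken s i

mutual
  _∋e_ : ∀ {t} → Sub t → Edge t → Set
  node s ∋e rootEdge i = taken s i
  node s ∋e below a    = s ∋es a

  _∋es_ : ∀ {cs} → Subs cs → Any Edge cs → Set
  skip s   ∋es here e  = ⊥
  take x s ∋es here e  = x ∋e e
  skip s   ∋es there a = s ∋es a
  take x s ∋es there a = s ∋es a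

-- outdegree of the root in a rooted subtree = number of included children
countTaken : ∀ {cs} → Subs cs → ℕ
countTaken []         = 0
countTaken (skip s)   = countTaken s
countTaken (take x s) = suc (countTaken s)

mutual
  OutdegOK : ∀ {t} → Sub t → Set
  OutdegOK (node {k} s) = countTaken s ≤ k × OutdegOKs s

  OutdegOKs : ∀ {cs} → Subs cs → Set
  OutdegOKs []         = ⊤
  OutdegOKs (skip s)   = OutdegOKs s
  OutdegOKs (take x s) = OutdegOK x × OutdegOKs s

record RootedCovering (t : RTree) (Xs : List (Sub t)) : Set where
  field
    coversEdges    : (e : Edge t) → Any (λ X → X ∋e e) Xs
    coversVertices : (v : Vertex t) → Any (λ X → X ∋v v) Xs

OutdegFRootedCovering : (t : RTree) → List (Sub t) → Set
OutdegFRootedCovering t Xs = RootedCovering t Xs × All OutdegOK Xs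

IsMinOutdegFCover : RTree → ℕ → Set
IsMinOutdegFCover t m =
  Σ (List (Sub t)) (λ Xs → OutdegFRootedCovering t Xs × length Xs ≡ m)
  × ((Xs : List (Sub t)) → OutdegFRootedCovering t Xs → m ≤ length Xs)

maximum : List ℕ → ℕ
maximum = foldr _⊔_ 0

-- ⌈ a / b ⌉ for b ≥ 1 (value at b = 0 is irrelevant junk)
ceilDiv : ℕ → ℕ → ℕ
ceilDiv a zero    = 0
ceilDiv a (suc n) = (a + n) / suc n

module Submission where

-- A rooted subtree of  node k Ts  is a sub-forest of Ts below the root, and
-- a sub-forest of  c ∷ cs  is an optional rooted subtree of c (its first
-- part) plus a sub-forest of cs (its rest).  So a covering of the forest is
-- exactly a rooted covering of the first tree by the first parts together
-- with a covering of the other trees by the rests (decompose / compose).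
-- The root outdegree of a member is its load, the number of trees it meets.
--   Lower bound: the parts of an optimal covering lying in Tᵢ cover Tᵢ, so
-- cᵢ ≤ |Xs|; counting loads, c₁ + … + cₙ ≤ f(r) · |Xs|.
--   Upper bound: for any M with cᵢ ≤ M and Σ cᵢ ≤ f(r) · M, the optimal
-- coverings of T₁, …, Tₙ are dealt round-robin into M slots.  A Schedule
-- keeps the slots as a queue whose loads are q, …, q, q+1, …, q+1; a
-- covering of size k ≤ M goes to the first k slots, which then move to the
-- back.  Balance forces every load to be at most f(r).
-- The theorem takes M = max (max cᵢ) ⌈Σ cᵢ / f(r)⌉, the least such M.

open import Defs
open import Data.Nat using (ℕ; _⊔_)
open import Data.List using (List; [])
open import Data.Nat.ListAction using (sum)
open import Data.List.Relation.Binary.Pointwise using (Pointwise)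
open import Relation.Binary.PropositionalEquality using (_≢_)

open import Data.Nat using (zero; suc; >-nonZero; _+_; _*_; _∸_; _≤_; _<_; z≤n; s≤s; s≤s⁻¹)
open import Data.Nat.Properties
open import Algebra.Properties.CommutativeSemigroup +-commutativeSemigroup using (x∙yz≈y∙xz)
open import Data.Nat.DivMod using (_%_; m≡m%n+[m/n]*n; m%n<n; m<n*o⇒m/o<n)
open import Data.Nat.Tactic.RingSolver using (solve-∀)
open import Data.List as List using (_∷_; _++_; length; map; replicate)
open import Data.List.Properties
  using (length-map; length-++; map-++; ++-assoc; length-replicate; length-take; length-drop; take-all; take++drop≡id)
open import Data.List.Relation.Unary.Any as Any using (Any; here; there)
open import Data.List.Relation.Unary.All as All using (All; []; _∷_)
import Data.List.Relation.Unary.Any.Properties as AnyP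
import Data.List.Relation.Unary.All.Properties as AllP
open import Data.List.Relation.Binary.Permutation.Propositional
  using (_↭_; ↭-sym; ↭-reflexive; ↭-trans; module PermutationReasoning)
open import Data.List.Relation.Binary.Permutation.Propositional.Properties
  using (Any-resp-↭; All-resp-↭; ++-comm; ++⁺ˡ; shifts)
open import Data.List.Relation.Binary.Pointwise using ([]; _∷_)
open import Data.Product using (Σ; _×_; _,_; proj₁; proj₂)
open import Data.Unit using (⊤; tt)
open import Data.Empty using (⊥-elim)
open import Relation.Binary.PropositionalEquality
  using (_≡_; refl; sym; trans; cong; cong₂; subst; module ≡-Reasoning)
open import Relation.Nullary using (yes; no)

forestPart : ∀ {k Ts} → Sub (node k Ts) → Subs Ts
forestPart (node s) = s

rest : ∀ {c cs} → Subs (c ∷ cs) → Subs cs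
rest (skip s)   = s
rest (take x s) = s

firstParts : ∀ {c cs} → List (Subs (c ∷ cs)) → List (Sub c)
firstParts []              = []
firstParts (skip s ∷ Ss)   = firstParts Ss
firstParts (take x s ∷ Ss) = x ∷ firstParts Ss

record CoversForest (Ts : List RTree) (Ss : List (Subs Ts)) : Set where
  field
    coversEdges    : (e : Any Edge Ts) → Any (λ S → S ∋es e) Ss
    coversVertices : (v : Any Vertex Ts) → Any (λ S → S ∋vs v) Ss
open CoversForest

ForestCovering : (Ts : List RTree) → List (Subs Ts) → Set
ForestCovering Ts Ss = CoversForest Ts Ss × All OutdegOKs Ss

ForestCovering-resp-↭ : ∀ {Ts} {Ss Ss′ : List (Subs Ts)} →
  Ss ↭ Ss′ → ForestCovering Ts Ss → ForestCovering Ts Ss′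
ForestCovering-resp-↭ p (cov , ok) =
  record { coversEdges    = λ e → Any-resp-↭ p (coversEdges cov e)
         ; coversVertices = λ v → Any-resp-↭ p (coversVertices cov v) }
  , All-resp-↭ p ok

module _ {c : RTree} {cs : List RTree} where

  firstEdge⁺ : (e : Edge c) (Ss : List (Subs (c ∷ cs))) →
    Any (λ S → S ∋es here e) Ss → Any (λ x → x ∋e e) (firstParts Ss)
  firstEdge⁺ e (skip s ∷ Ss)   (there p) = firstEdge⁺ e Ss p
  firstEdge⁺ e (take x s ∷ Ss) (here p)  = here p
  firstEdge⁺ e (take x s ∷ Ss) (there p) = there (firstEdge⁺ e Ss p)

  firstEdge⁻ : (e : Edge c) (Ss : List (Subs (c ∷ cs))) →
    Any (λ x → x ∋e e) (firstParts Ss) → Any (λ S → S ∋es here e) Ss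
  firstEdge⁻ e (skip s ∷ Ss)   p         = there (firstEdge⁻ e Ss p)
  firstEdge⁻ e (take x s ∷ Ss) (here p)  = here p
  firstEdge⁻ e (take x s ∷ Ss) (there p) = there (firstEdge⁻ e Ss p)

  firstVertex⁺ : (v : Vertex c) (Ss : List (Subs (c ∷ cs))) →
    Any (λ S → S ∋vs here v) Ss → Any (λ x → x ∋v v) (firstParts Ss)
  firstVertex⁺ v (skip s ∷ Ss)   (there p) = firstVertex⁺ v Ss p
  firstVertex⁺ v (take x s ∷ Ss) (here p)  = here p
  firstVertex⁺ v (take x s ∷ Ss) (there p) = there (firstVertex⁺ v Ss p)

  firstVertex⁻ : (v : Vertex c) (Ss : List (Subs (c ∷ cs))) →
    Any (λ x → x ∋v v) (firstParts Ss) → Any (λ S → S ∋vs here v) Ss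
  firstVertex⁻ v (skip s ∷ Ss)   p         = there (firstVertex⁻ v Ss p)
  firstVertex⁻ v (take x s ∷ Ss) (here p)  = here p
  firstVertex⁻ v (take x s ∷ Ss) (there p) = there (firstVertex⁻ v Ss p)

  restEdge⁺ : (e : Any Edge cs) (S : Subs (c ∷ cs)) → S ∋es there e → rest S ∋es e
  restEdge⁺ e (skip s)   p = p
  restEdge⁺ e (take x s) p = p

  restEdge⁻ : (e : Any Edge cs) (S : Subs (c ∷ cs)) → rest S ∋es e → S ∋es there e
  restEdge⁻ e (skip s)   p = p
  restEdge⁻ e (take x s) p = p

  restVertex⁺ : (v : Any Vertex cs) (S : Subs (c ∷ cs)) → S ∋vs there v → rest S ∋vs v
  restVertex⁺ v (skip s)   p = p
  restVertex⁺ v (take x s) p = p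

  restVertex⁻ : (v : Any Vertex cs) (S : Subs (c ∷ cs)) → rest S ∋vs v → S ∋vs there v
  restVertex⁻ v (skip s)   p = p
  restVertex⁻ v (take x s) p = p

  anyRest⁻ : {P : Subs cs → Set} {Q : Subs (c ∷ cs) → Set} →
    ((S : Subs (c ∷ cs)) → P (rest S) → Q S) →
    (Ss : List (Subs (c ∷ cs))) → Any P (map rest Ss) → Any Q Ss
  anyRest⁻ f (S ∷ Ss) (here p)  = here (f S p)
  anyRest⁻ f (S ∷ Ss) (there p) = there (anyRest⁻ f Ss p)

  firstOK : (Ss : List (Subs (c ∷ cs))) → All OutdegOKs Ss → All OutdegOK (firstParts Ss)
  firstOK []              []               = []
  firstOK (skip s ∷ Ss)   (_ ∷ oks)        = firstOK Ss oks
  firstOK (take x s ∷ Ss) ((ok , _) ∷ oks) = ok ∷ firstOK Ss oks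

  restOK : (S : Subs (c ∷ cs)) → OutdegOKs S → OutdegOKs (rest S)
  restOK (skip s)   ok       = ok
  restOK (take x s) (_ , ok) = ok

  consOK : (Ss : List (Subs (c ∷ cs))) →
    All OutdegOK (firstParts Ss) → All OutdegOKs (map rest Ss) → All OutdegOKs Ss
  consOK []              _           _             = []
  consOK (skip s ∷ Ss)   oksF        (ok ∷ oksR)   = ok ∷ consOK Ss oksF oksR
  consOK (take x s ∷ Ss) (okF ∷ oksF) (ok ∷ oksR) = (okF , ok) ∷ consOK Ss oksF oksR

  decompose : (Ss : List (Subs (c ∷ cs))) → ForestCovering (c ∷ cs) Ss →
    OutdegFRootedCovering c (firstParts Ss) × ForestCovering cs (map rest Ss)
  decompose Ss (cov , ok) =
    ( record
        { coversEdges    = λ e → firstEdge⁺ e Ss (coversEdges cov (here e))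
        ; coversVertices = λ v → firstVertex⁺ v Ss (coversVertices cov (here v)) }
    , firstOK Ss ok )
    , record
        { coversEdges    = λ e → AnyP.map⁺ (Any.map (λ {S} → restEdge⁺ e S) (coversEdges cov (there e)))
        ; coversVertices = λ v → AnyP.map⁺ (Any.map (λ {S} → restVertex⁺ v S) (coversVertices cov (there v))) }
    , AllP.map⁺ (All.map (λ {S} → restOK S) ok)

  compose : (Ss : List (Subs (c ∷ cs))) →
    OutdegFRootedCovering c (firstParts Ss) → ForestCovering cs (map rest Ss) →
    ForestCovering (c ∷ cs) Ss
  compose Ss (rc , oksF) (cov , oksR) =
    record { coversEdges = edges ; coversVertices = vertices } , consOK Ss oksF oksR
    where
    edges : (e : Any Edge (c ∷ cs)) → Any (λ S → S ∋es e) Ss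
    edges (here e)  = firstEdge⁻ e Ss (RootedCovering.coversEdges rc e)
    edges (there e) = anyRest⁻ (restEdge⁻ e) Ss (coversEdges cov e)
    vertices : (v : Any Vertex (c ∷ cs)) → Any (λ S → S ∋vs v) Ss
    vertices (here v)  = firstVertex⁻ v Ss (RootedCovering.coversVertices rc v)
    vertices (there v) = anyRest⁻ (restVertex⁻ v) Ss (coversVertices cov v)

childRoot : ∀ {Ts} → Any (λ _ → ⊤) Ts → Any Vertex Ts
childRoot (here {node _ _} _) = here root
childRoot (there i)           = there (childRoot i)

-- A sub-forest containing the root of the i-th tree includes that tree,
-- so the subtree over it contains the edge from the root to that tree.
childRoot⇒taken : ∀ {Ts} (S : Subs Ts) (i : Any (λ _ → ⊤) Ts) → S ∋vs childRoot i → taken S i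
childRoot⇒taken (skip S)   (here {node _ _} _) ()
childRoot⇒taken (take x S) (here {node _ _} _) _ = tt
childRoot⇒taken (skip S)   (there i)           p = childRoot⇒taken S i p
childRoot⇒taken (take x S) (there i)           p = childRoot⇒taken S i p

covering-nonempty : ∀ {Ts} → Ts ≢ [] → (Q : List (Subs Ts)) → CoversForest Ts Q → Any (λ _ → ⊤) Q
covering-nonempty {[]}    nonempty _ _   = ⊥-elim (nonempty refl)
covering-nonempty {_ ∷ _} _        _ cov = Any.map (λ _ → tt) (coversVertices cov (childRoot (here tt)))

module _ {k : ℕ} {Ts : List RTree} where

  belowEdge : (e : Any Edge Ts) (X : Sub (node k Ts)) → X ∋e below e → forestPart X ∋es e
  belowEdge e (node s) p = p

  belowVertex : (v : Any Vertex Ts) (X : Sub (node k Ts)) → X ∋v below v → forestPart X ∋vs v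
  belowVertex v (node s) p = p

  splitOK : (X : Sub (node k Ts)) → OutdegOK X →
    countTaken (forestPart X) ≤ k × OutdegOKs (forestPart X)
  splitOK (node s) ok = ok

  toForest : (Xs : List (Sub (node k Ts))) → OutdegFRootedCovering (node k Ts) Xs →
    ForestCovering Ts (map forestPart Xs) × All (λ S → countTaken S ≤ k) (map forestPart Xs)
  toForest Xs (rc , ok) =
    ( record
        { coversEdges    = λ e → AnyP.map⁺ (Any.map (λ {X} → belowEdge e X)
                                                     (RootedCovering.coversEdges rc (below e)))
        ; coversVertices = λ v → AnyP.map⁺ (Any.map (λ {X} → belowVertex v X)
                                                     (RootedCovering.coversVertices rc (below v))) }
    , AllP.map⁺ (All.map (λ {X} o → proj₂ (splitOK X o)) ok) )
    , AllP.map⁺ (All.map (λ {X} o → proj₁ (splitOK X o)) ok)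

  fromForest : Ts ≢ [] → (Q : List (Subs Ts)) → ForestCovering Ts Q →
    All (λ S → countTaken S ≤ k) Q → OutdegFRootedCovering (node k Ts) (map node Q)
  fromForest nonempty Q (cov , ok) loads =
    record { coversEdges = edges ; coversVertices = vertices }
    , AllP.map⁺ (All.zip (loads , ok))
    where
    edges : (e : Edge (node k Ts)) → Any (λ X → X ∋e e) (map node Q)
    edges (rootEdge i) = AnyP.map⁺ (Any.map (λ {S} → childRoot⇒taken S i)
                                            (coversVertices cov (childRoot i)))
    edges (below e)    = AnyP.map⁺ (coversEdges cov e)
    vertices : (v : Vertex (node k Ts)) → Any (λ X → X ∋v v) (map node Q)
    vertices (below v) = AnyP.map⁺ (coversVertices cov v)
    vertices root      = AnyP.map⁺ (covering-nonempty nonempty Q cov)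

totalLoad : ∀ {Ts} → List (Subs Ts) → ℕ
totalLoad Ss = sum (map countTaken Ss)

totalLoad-bound : ∀ {Ts k} (Ss : List (Subs Ts)) →
  All (λ S → countTaken S ≤ k) Ss → totalLoad Ss ≤ length Ss * k
totalLoad-bound []       []         = z≤n
totalLoad-bound (S ∷ Ss) (le ∷ les) = +-mono-≤ le (totalLoad-bound Ss les)

module _ {c : RTree} {cs : List RTree} where

  -- Every first part accounts for one unit of load on the first tree.
  totalLoad-split : (Ss : List (Subs (c ∷ cs))) →
    totalLoad Ss ≡ length (firstParts Ss) + totalLoad (map rest Ss)
  totalLoad-split []              = refl
  totalLoad-split (skip s ∷ Ss)   =
    trans (cong (countTaken s +_) (totalLoad-split Ss))
          (x∙yz≈y∙xz (countTaken s) (length (firstParts Ss)) (totalLoad (map rest Ss)))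
  totalLoad-split (take x s ∷ Ss) =
    cong suc (trans (cong (countTaken s +_) (totalLoad-split Ss))
                    (x∙yz≈y∙xz (countTaken s) (length (firstParts Ss)) (totalLoad (map rest Ss))))

  length-firstParts : (Ss : List (Subs (c ∷ cs))) → length (firstParts Ss) ≤ length Ss
  length-firstParts []              = z≤n
  length-firstParts (skip s ∷ Ss)   = m≤n⇒m≤1+n (length-firstParts Ss)
  length-firstParts (take x s ∷ Ss) = s≤s (length-firstParts Ss)

-- Lower bounds for a forest covering Ss of T₁ … Tₙ, where cᵢ is the
-- optimum for Tᵢ: the first parts on Tᵢ form a rooted covering of Tᵢ, so
-- cᵢ ≤ |Ss|, and summing over i shows that c₁ + … + cₙ ≤ totalLoad Ss.
forestLowerBound : ∀ {Ts cs} → Pointwise IsMinOutdegFCover Ts cs →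
  (Ss : List (Subs Ts)) → ForestCovering Ts Ss →
  All (_≤ length Ss) cs × sum cs ≤ totalLoad Ss
forestLowerBound []           Ss _  = [] , z≤n
forestLowerBound {T ∷ Ts} {c ∷ cs} (opt ∷ opts) Ss fc =
  ≤-trans c≤first (length-firstParts Ss)
    ∷ subst (λ m → All (_≤ m) cs) (length-map rest Ss) (proj₁ restBounds)
  , ≤-trans (+-mono-≤ c≤first (proj₂ restBounds)) (≤-reflexive (sym (totalLoad-split Ss)))
  where
  parts : OutdegFRootedCovering T (firstParts Ss) × ForestCovering Ts (map rest Ss)
  parts = decompose Ss fc
  c≤first : c ≤ length (firstParts Ss)
  c≤first = proj₂ opt (firstParts Ss) (proj₁ parts)
  restBounds : All (_≤ length (map rest Ss)) cs × sum cs ≤ totalLoad (map rest Ss)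
  restBounds = forestLowerBound opts (map rest Ss) (proj₂ parts)

ceilDiv-least : ∀ s n L → s ≤ L * suc n → ceilDiv s (suc n) ≤ L
ceilDiv-least s n L s≤Ln = s≤s⁻¹ (m<n*o⇒m/o<n {s + n} {suc L} {suc n} s+n<[L+1][n+1])
  where
  s+n<[L+1][n+1] : s + n < suc L * suc n
  s+n<[L+1][n+1] = s≤s (≤-trans (+-monoˡ-≤ n s≤Ln) (≤-reflexive (+-comm (L * suc n) n)))

ceilDiv-sufficient : ∀ s n → s ≤ ceilDiv s (suc n) * suc n
ceilDiv-sufficient s n = +-cancelˡ-≤ n s _ (begin
  n + s                                        ≡⟨ +-comm n s ⟩
  s + n                                        ≡⟨ m≡m%n+[m/n]*n (s + n) (suc n) ⟩
  (s + n) % suc n + ceilDiv s (suc n) * suc n  ≤⟨ +-monoˡ-≤ _ (s≤s⁻¹ (m%n<n (s + n) (suc n))) ⟩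
  n + ceilDiv s (suc n) * suc n                ∎)
  where open ≤-Reasoning

maximum-least : ∀ {L} (cs : List ℕ) → All (_≤ L) cs → maximum cs ≤ L
maximum-least []       []         = z≤n
maximum-least (c ∷ cs) (le ∷ les) = ⊔-lub le (maximum-least cs les)

≤-maximum : (cs : List ℕ) → All (_≤ maximum cs) cs
≤-maximum []       = []
≤-maximum (c ∷ cs) = m≤m⊔n c _ ∷ All.map (λ le → ≤-trans le (m≤n⊔m c _)) (≤-maximum cs)

rotate↭ : ∀ {A : Set} k (xs ys : List A) → List.drop k xs ++ ys ++ List.take k xs ↭ xs ++ ys
rotate↭ k xs ys = begin
  List.drop k xs ++ ys ++ List.take k xs   ↭⟨ ++⁺ˡ (List.drop k xs) (++-comm ys (List.take k xs)) ⟩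
  List.drop k xs ++ List.take k xs ++ ys   ↭⟨ shifts (List.drop k xs) (List.take k xs) ⟩
  List.take k xs ++ List.drop k xs ++ ys   ≡⟨ sym (++-assoc (List.take k xs) _ ys) ⟩
  (List.take k xs ++ List.drop k xs) ++ ys ≡⟨ cong (_++ ys) (take++drop≡id k xs) ⟩
  xs ++ ys                                 ∎
  where open PermutationReasoning

module _ {c : RTree} {cs : List RTree} where

  skips : List (Subs cs) → List (Subs (c ∷ cs))
  skips = map skip

  attach : List (Sub c) → List (Subs cs) → List (Subs (c ∷ cs))
  attach (y ∷ Ys) (s ∷ S) = take y s ∷ attach Ys S
  attach _        _       = []

  firstParts-++ : (Ss Ss′ : List (Subs (c ∷ cs))) →
    firstParts (Ss ++ Ss′) ≡ firstParts Ss ++ firstParts Ss′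
  firstParts-++ []              Ss′ = refl
  firstParts-++ (skip s ∷ Ss)   Ss′ = firstParts-++ Ss Ss′
  firstParts-++ (take x s ∷ Ss) Ss′ = cong (x ∷_) (firstParts-++ Ss Ss′)

  firstParts-skips++ : (X : List (Subs cs)) (Ss : List (Subs (c ∷ cs))) →
    firstParts (skips X ++ Ss) ≡ firstParts Ss
  firstParts-skips++ []      Ss = refl
  firstParts-skips++ (s ∷ X) Ss = firstParts-skips++ X Ss

  rest-skips++ : (X : List (Subs cs)) (Ss : List (Subs (c ∷ cs))) →
    map rest (skips X ++ Ss) ≡ X ++ map rest Ss
  rest-skips++ []      Ss = refl
  rest-skips++ (s ∷ X) Ss = cong (s ∷_) (rest-skips++ X Ss)

  length-skips++ : (X : List (Subs cs)) (Ss : List (Subs (c ∷ cs))) →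
    length (skips X ++ Ss) ≡ length X + length Ss
  length-skips++ []      Ss = refl
  length-skips++ (s ∷ X) Ss = cong suc (length-skips++ X Ss)

  firstParts-attach : (Ys : List (Sub c)) (S : List (Subs cs)) →
    length Ys ≤ length S → firstParts (attach Ys S) ≡ Ys
  firstParts-attach []       _       _        = refl
  firstParts-attach (y ∷ Ys) (s ∷ S) (s≤s le) = cong (y ∷_) (firstParts-attach Ys S le)

  rest-attach : (Ys : List (Sub c)) (S : List (Subs cs)) →
    map rest (attach Ys S) ≡ List.take (length Ys) S
  rest-attach []       _       = refl
  rest-attach (y ∷ Ys) []      = refl
  rest-attach (y ∷ Ys) (s ∷ S) = cong (s ∷_) (rest-attach Ys S)

  length-attach : (Ys : List (Sub c)) (S : List (Subs cs)) →
    length Ys ≤ length S → length (attach Ys S) ≡ length Ys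
  length-attach []       _       _        = refl
  length-attach (y ∷ Ys) (s ∷ S) (s≤s le) = cong suc (length-attach Ys S le)

  lowQueue-firstParts : (X Y Z : List (Subs cs)) (Ys : List (Sub c)) → length Ys ≤ length Z →
    firstParts (skips X ++ skips Y ++ attach Ys Z) ≡ Ys
  lowQueue-firstParts X Y Z Ys le =
    trans (firstParts-skips++ X _) (trans (firstParts-skips++ Y _) (firstParts-attach Ys Z le))

  lowQueue-rests : (X Y Z : List (Subs cs)) (Ys : List (Sub c)) →
    map rest (skips X ++ skips Y ++ attach Ys Z) ≡ X ++ Y ++ List.take (length Ys) Z
  lowQueue-rests X Y Z Ys =
    trans (rest-skips++ X _) (cong (X ++_) (trans (rest-skips++ Y _) (cong (Y ++_) (rest-attach Ys Z))))

  wrapQueue-firstParts : (X Z₁ Z₂ : List (Subs cs)) (Ys₁ Ys₂ : List (Sub c)) →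
    length Ys₁ ≤ length Z₁ → length Ys₂ ≤ length Z₂ →
    firstParts ((skips X ++ attach Ys₁ Z₁) ++ attach Ys₂ Z₂) ≡ Ys₁ ++ Ys₂
  wrapQueue-firstParts X Z₁ Z₂ Ys₁ Ys₂ le₁ le₂ = begin
    firstParts ((skips X ++ attach Ys₁ Z₁) ++ attach Ys₂ Z₂)  ≡⟨ cong firstParts (++-assoc (skips X) _ _) ⟩
    firstParts (skips X ++ attach Ys₁ Z₁ ++ attach Ys₂ Z₂)    ≡⟨ firstParts-skips++ X _ ⟩
    firstParts (attach Ys₁ Z₁ ++ attach Ys₂ Z₂)              ≡⟨ firstParts-++ (attach Ys₁ Z₁) _ ⟩
    firstParts (attach Ys₁ Z₁) ++ firstParts (attach Ys₂ Z₂)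
      ≡⟨ cong₂ _++_ (firstParts-attach Ys₁ Z₁ le₁) (firstParts-attach Ys₂ Z₂ le₂) ⟩
    Ys₁ ++ Ys₂                                              ∎
    where open ≡-Reasoning

  wrapQueue-rests : (X Z₁ Z₂ : List (Subs cs)) (Ys₁ Ys₂ : List (Sub c)) →
    map rest ((skips X ++ attach Ys₁ Z₁) ++ attach Ys₂ Z₂)
      ≡ X ++ List.take (length Ys₁) Z₁ ++ List.take (length Ys₂) Z₂
  wrapQueue-rests X Z₁ Z₂ Ys₁ Ys₂ = begin
    map rest ((skips X ++ attach Ys₁ Z₁) ++ attach Ys₂ Z₂)  ≡⟨ cong (map rest) (++-assoc (skips X) _ _) ⟩
    map rest (skips X ++ attach Ys₁ Z₁ ++ attach Ys₂ Z₂)    ≡⟨ rest-skips++ X _ ⟩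
    X ++ map rest (attach Ys₁ Z₁ ++ attach Ys₂ Z₂)          ≡⟨ cong (X ++_) (map-++ rest (attach Ys₁ Z₁) _) ⟩
    X ++ map rest (attach Ys₁ Z₁) ++ map rest (attach Ys₂ Z₂)
      ≡⟨ cong (X ++_) (cong₂ _++_ (rest-attach Ys₁ Z₁) (rest-attach Ys₂ Z₂)) ⟩
    X ++ List.take (length Ys₁) Z₁ ++ List.take (length Ys₂) Z₂ ∎
    where open ≡-Reasoning

  attach-load : ∀ {q} (Ys : List (Sub c)) (S : List (Subs cs)) →
    All (λ s → countTaken s ≤ q) S → All (λ s → countTaken s ≤ suc q) (attach Ys S)
  attach-load []       _       _          = []
  attach-load (y ∷ Ys) []      _          = []
  attach-load (y ∷ Ys) (s ∷ S) (le ∷ les) = s≤s le ∷ attach-load Ys S les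

  extend : ∀ {Q Ys} → ForestCovering cs Q → OutdegFRootedCovering c Ys →
    (Ss : List (Subs (c ∷ cs))) → firstParts Ss ≡ Ys → map rest Ss ↭ Q →
    ForestCovering (c ∷ cs) Ss
  extend fc rc Ss refl rests↭Q = compose Ss rc (ForestCovering-resp-↭ (↭-sym rests↭Q) fc)

record Schedule (Ts : List RTree) (M P : ℕ) : Set where
  field
    level    : ℕ
    low high : List (Subs Ts)
    slots    : length low + length high ≡ M
    lowLoad  : All (λ S → countTaken S ≤ level) low
    highLoad : All (λ S → countTaken S ≤ suc level) high
    demand   : P ≡ level * M + length high
    covering : ForestCovering Ts (low ++ high)

emptySchedule : (M : ℕ) → Schedule [] M 0
emptySchedule M = record
  { level    = 0
  ; low      = replicate M []
  ; high     = []
  ; slots    = trans (+-identityʳ _) (length-replicate M)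
  ; lowLoad  = AllP.replicate⁺ M z≤n
  ; highLoad = []
  ; demand   = refl
  ; covering = record { coversEdges = λ () ; coversVertices = λ () }
             , AllP.++⁺ (AllP.replicate⁺ M tt) [] }

low-slots : ∀ {k l} h → k ≤ l → (l ∸ k) + (h + k) ≡ l + h
low-slots {k} {l} h k≤l = begin
  (l ∸ k) + (h + k)  ≡⟨ cong ((l ∸ k) +_) (+-comm h k) ⟩
  (l ∸ k) + (k + h)  ≡⟨ +-assoc (l ∸ k) k h ⟨
  ((l ∸ k) + k) + h  ≡⟨ cong (_+ h) (m∸n+n≡m k≤l) ⟩
  l + h              ∎
  where open ≡-Reasoning

wrap-slots : ∀ {d h} l → d ≤ h → ((h ∸ d) + l) + d ≡ l + h
wrap-slots {d} {h} l d≤h = begin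
  ((h ∸ d) + l) + d  ≡⟨ +-assoc (h ∸ d) l d ⟩
  (h ∸ d) + (l + d)  ≡⟨ x∙yz≈y∙xz (h ∸ d) l d ⟩
  l + ((h ∸ d) + d)  ≡⟨ cong (l +_) (m∸n+n≡m d≤h) ⟩
  l + h              ∎
  where open ≡-Reasoning

low-demand : ∀ k x h → k + (x + h) ≡ x + (h + k)
low-demand = solve-∀

wrap-demand : ∀ l d x h → (l + d) + (x + h) ≡ ((l + h) + x) + d
wrap-demand = solve-∀

module _ {c : RTree} {cs : List RTree} {M P : ℕ} (st : Schedule cs M P)
         (Ys : List (Sub c)) (rc : OutdegFRootedCovering c Ys) where
  open Schedule st

  private
    k : ℕ
    k = length Ys

  serveLow : k ≤ length low → Schedule (c ∷ cs) M (k + P)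
  serveLow k≤low = record
    { level    = level
    ; low      = skips (List.drop k low)
    ; high     = skips high ++ attach Ys low
    ; slots    = slots′
    ; lowLoad  = AllP.map⁺ (AllP.drop⁺ k lowLoad)
    ; highLoad = AllP.++⁺ (AllP.map⁺ highLoad) (attach-load Ys low lowLoad)
    ; demand   = demand′
    ; covering = extend covering rc (skips (List.drop k low) ++ skips high ++ attach Ys low)
                        (lowQueue-firstParts (List.drop k low) high low Ys k≤low) rests↭ }
    where
    open ≡-Reasoning
    length-high′ : length (skips {c} high ++ attach Ys low) ≡ length high + k
    length-high′ = trans (length-skips++ high _) (cong (length high +_) (length-attach Ys low k≤low))
    slots′ : length (skips {c} (List.drop k low)) + length (skips high ++ attach Ys low) ≡ M
    slots′ = begin
      length (skips {c} (List.drop k low)) + length (skips high ++ attach Ys low)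
        ≡⟨ cong₂ _+_ (trans (length-map skip (List.drop k low)) (length-drop k low)) length-high′ ⟩
      (length low ∸ k) + (length high + k)  ≡⟨ low-slots (length high) k≤low ⟩
      length low + length high              ≡⟨ slots ⟩
      M                                     ∎
    demand′ : k + P ≡ level * M + length (skips {c} high ++ attach Ys low)
    demand′ = begin
      k + P                            ≡⟨ cong (k +_) demand ⟩
      k + (level * M + length high)    ≡⟨ low-demand k (level * M) (length high) ⟩
      level * M + (length high + k)    ≡⟨ cong (level * M +_) length-high′ ⟨
      level * M + length (skips high ++ attach Ys low) ∎
    rests↭ : map rest (skips (List.drop k low) ++ skips high ++ attach Ys low) ↭ low ++ high
    rests↭ = ↭-trans (↭-reflexive (lowQueue-rests (List.drop k low) high low Ys)) (rotate↭ k low high)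

  -- If Ys does not fit into the l low slots, it is split as Ys₁ ++ Ys₂ with
  -- |Ys₁| = l and |Ys₂| = d = k ∸ l: Ys₁ goes to all low slots, Ys₂ to the
  -- first d high slots.  The level rises by one; the served high slots
  -- become the new high slots, everything else the new low slots.
  serveWrap : length low < k → k ≤ M → Schedule (c ∷ cs) M (k + P)
  serveWrap low<k k≤M = record
    { level    = suc level
    ; low      = skips (List.drop d high) ++ attach Ys₁ low
    ; high     = attach Ys₂ high
    ; slots    = slots′
    ; lowLoad  = AllP.++⁺ (AllP.map⁺ (AllP.drop⁺ d highLoad)) (attach-load Ys₁ low lowLoad)
    ; highLoad = attach-load Ys₂ high highLoad
    ; demand   = demand′
    ; covering = extend covering rc ((skips (List.drop d high) ++ attach Ys₁ low) ++ attach Ys₂ high)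
                        firstParts≡Ys rests↭ }
    where
    open ≡-Reasoning
    l d : ℕ
    l = length low
    d = k ∸ l
    Ys₁ Ys₂ : List (Sub c)
    Ys₁ = List.take l Ys
    Ys₂ = List.drop l Ys
    d≤high : d ≤ length high
    d≤high = m≤n+o⇒m∸n≤o k l (≤-trans k≤M (≤-reflexive (sym slots)))
    length-Ys₁ : length Ys₁ ≡ l
    length-Ys₁ = trans (length-take l Ys) (m≤n⇒m⊓n≡m (<⇒≤ low<k))
    Ys₂≤high : length Ys₂ ≤ length high
    Ys₂≤high = ≤-trans (≤-reflexive (length-drop l Ys)) d≤high
    length-high′ : length (attach Ys₂ high) ≡ d
    length-high′ = trans (length-attach Ys₂ high Ys₂≤high) (length-drop l Ys)
    slots′ : length (skips {c} (List.drop d high) ++ attach Ys₁ low) + length (attach Ys₂ high) ≡ M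
    slots′ = begin
      length (skips {c} (List.drop d high) ++ attach Ys₁ low) + length (attach Ys₂ high)
        ≡⟨ cong₂ _+_ (trans (length-skips++ (List.drop d high) _)
                            (cong₂ _+_ (length-drop d high)
                                       (trans (length-attach Ys₁ low (≤-reflexive length-Ys₁)) length-Ys₁)))
                     length-high′ ⟩
      ((length high ∸ d) + l) + d  ≡⟨ wrap-slots l d≤high ⟩
      l + length high              ≡⟨ slots ⟩
      M                            ∎
    demand′ : k + P ≡ suc level * M + length (attach Ys₂ high)
    demand′ = begin
      k + P                                ≡⟨ cong₂ _+_ (sym (m+[n∸m]≡n (<⇒≤ low<k))) demand ⟩
      (l + d) + (level * M + length high)  ≡⟨ wrap-demand l d (level * M) (length high) ⟩
      ((l + length high) + level * M) + d  ≡⟨ cong₂ (λ m e → (m + level * M) + e) slots (sym length-high′) ⟩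
      suc level * M + length (attach Ys₂ high) ∎
    firstParts≡Ys : firstParts ((skips (List.drop d high) ++ attach Ys₁ low) ++ attach Ys₂ high) ≡ Ys
    firstParts≡Ys = trans (wrapQueue-firstParts (List.drop d high) low high Ys₁ Ys₂ (≤-reflexive length-Ys₁) Ys₂≤high)
                          (take++drop≡id l Ys)
    rests : map rest ((skips (List.drop d high) ++ attach Ys₁ low) ++ attach Ys₂ high)
          ≡ List.drop d high ++ low ++ List.take d high
    rests = trans (wrapQueue-rests (List.drop d high) low high Ys₁ Ys₂)
                  (cong₂ (λ R e → List.drop d high ++ R ++ List.take e high)
                         (trans (cong (λ m → List.take m low) length-Ys₁) (take-all l low ≤-refl))
                         (length-drop l Ys))
    rests↭ : map rest ((skips (List.drop d high) ++ attach Ys₁ low) ++ attach Ys₂ high) ↭ low ++ high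
    rests↭ = ↭-trans (↭-reflexive rests) (↭-trans (rotate↭ d high low) (++-comm high low))

  serve : k ≤ M → Schedule (c ∷ cs) M (k + P)
  serve k≤M with k ≤? length low
  ... | yes k≤low = serveLow k≤low
  ... | no  k≰low = serveWrap (≰⇒> k≰low) k≤M

schedule : ∀ {Ts cs} (M : ℕ) → Pointwise IsMinOutdegFCover Ts cs → All (_≤ M) cs →
  Schedule Ts M (sum cs)
schedule M []                               []           = emptySchedule M
schedule M (((Ys , rc , refl) , _) ∷ opts) (k≤M ∷ les) = serve (schedule M opts les) Ys rc k≤M

weaken-bound : ∀ {Ts a b} (Ss : List (Subs Ts)) → All (λ S → countTaken S ≤ a) Ss →
  (0 < length Ss → a ≤ b) → All (λ S → countTaken S ≤ b) Ss
weaken-bound []       []  _   = []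
weaken-bound (S ∷ Ss) les a≤b = All.map (λ le → ≤-trans le (a≤b (s≤s z≤n))) les

-- Balance pays off: if the demand is at most k · M, every slot of a
-- schedule uses at most k trees (low slots since q · M ≤ k · M, high
-- slots since q · M < q · M + #high ≤ k · M).
schedule-bounded : ∀ {Ts M P k} (st : Schedule Ts M P) → P ≤ k * M →
  All (λ S → countTaken S ≤ k) (Schedule.low st ++ Schedule.high st)
schedule-bounded {M = M} {k = k} st P≤kM =
  AllP.++⁺ (weaken-bound low lowLoad level≤k) (weaken-bound high highLoad level<k)
  where
  open Schedule st
  demand≤kM : level * M + length high ≤ k * M
  demand≤kM = subst (_≤ k * M) demand P≤kM
  level≤k : 0 < length low → level ≤ k
  level≤k low≢[] = *-cancelʳ-≤ level k M {{>-nonZero 0<M}} (≤-trans (m≤m+n _ _) demand≤kM)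
    where
    0<M : 0 < M
    0<M = ≤-trans low≢[] (≤-trans (m≤m+n _ _) (≤-reflexive slots))
  level<k : 0 < length high → suc level ≤ k
  level<k high≢[] = *-cancelʳ-< M level k (<-≤-trans (m<m+n (level * M) high≢[]) demand≤kM)

rootUpperBound : ∀ {k Ts cs} (M : ℕ) → Ts ≢ [] → Pointwise IsMinOutdegFCover Ts cs →
  All (_≤ M) cs → sum cs ≤ k * M →
  Σ (List (Sub (node k Ts))) (λ Xs → OutdegFRootedCovering (node k Ts) Xs × length Xs ≡ M)
rootUpperBound {k} {Ts} {cs} M nonempty opts cs≤M demand≤kM =
  map node (low ++ high)
  , fromForest nonempty (low ++ high) covering (schedule-bounded st demand≤kM)
  , trans (length-map node (low ++ high)) (trans (length-++ low) slots)
  where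
  st : Schedule Ts M (sum cs)
  st = schedule M opts cs≤M
  open Schedule st

rootLowerBound : ∀ {n Ts cs} → Pointwise IsMinOutdegFCover Ts cs →
  (Xs : List (Sub (node (suc n) Ts))) → OutdegFRootedCovering (node (suc n) Ts) Xs →
  maximum cs ⊔ ceilDiv (sum cs) (suc n) ≤ length Xs
rootLowerBound {n} {Ts} {cs} opts Xs cover =
  subst (maximum cs ⊔ ceilDiv (sum cs) (suc n) ≤_) (length-map forestPart Xs)
        (⊔-lub (maximum-least cs (proj₁ bounds))
               (ceilDiv-least (sum cs) n _ (≤-trans (proj₂ bounds) (totalLoad-bound Ss (proj₂ forest)))))
  where
  Ss : List (Subs Ts)
  Ss = map forestPart Xs
  forest : ForestCovering Ts Ss × All (λ S → countTaken S ≤ suc n) Ss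
  forest = toForest Xs cover
  bounds : All (_≤ length Ss) cs × sum cs ≤ totalLoad Ss
  bounds = forestLowerBound opts Ss (proj₁ forest)

mainTheorem9 : (fr : ℕ) (Ts : List RTree) → Binding (node fr Ts) → Ts ≢ []
    → (cs : List ℕ) → Pointwise IsMinOutdegFCover Ts cs
    → IsMinOutdegFCover (node fr Ts) (maximum cs ⊔ ceilDiv (sum cs) fr)
mainTheorem9 zero    Ts (node () _) nonempty cs opts
mainTheorem9 (suc n) Ts (node _ _)  nonempty cs opts =
  rootUpperBound M nonempty opts cs≤M demand≤ , rootLowerBound opts
  where
  M : ℕ
  M = maximum cs ⊔ ceilDiv (sum cs) (suc n)
  cs≤M : All (_≤ M) cs
  cs≤M = All.map (λ c≤max → ≤-trans c≤max (m≤m⊔n _ _)) (≤-maximum cs)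
  demand≤ : sum cs ≤ suc n * M
  demand≤ = begin
    sum cs                                ≤⟨ ceilDiv-sufficient (sum cs) n ⟩
    ceilDiv (sum cs) (suc n) * suc n      ≤⟨ *-monoˡ-≤ (suc n) (m≤n⊔m (maximum cs) _) ⟩
    M * suc n                             ≡⟨ *-comm M (suc n) ⟩
    suc n * M                             ∎
    where open ≤-Reasoning
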